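{- Let $f:\mathbb{N}\to\mathbb{N}$ satisfy $f(n)\to\infty$ as $n\to\infty$. Let $k \geq 2$ and $0<\varepsilon <1$. Then for all sufficiently large $d$, \[ M_{f,k}(d) \geq \max \left\{ n \in \mathbb{N} \;\middle|\; f(n) \leq (1 - \varepsilon) \cdot \left( \frac{2d}{k} \right)^{k/(k-1)} \right\} . \]
   Context: $\mathbb{N}=\{1,2,3,\dots\}$. $\Delta_{f,k}(n) := \min\{|f(n) - m^k| : m \in \mathbb{Z}\}$. For $d\ge0$: $M_{f,k}(d) := \max\{n \in \mathbb{N} : \Delta_{f,k}(n) \le d\}$ if this maximum exists, and $\infty$ otherwise.
   Formalization: The parameter ε and the values of d for which the bound on $M_{f,k}(d)$ is asserted are taken over the rationals. -}

module Defs where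

open import Data.Nat using (ℕ; zero; suc)
import Data.Nat as ℕ
open import Data.Integer as ℤ using (ℤ; +_; ∣_∣)
open import Data.Rational as ℚ using (ℚ; _/_; 0ℚ; 1ℚ)
open import Data.Product using (Σ; _×_; ∃-syntax)

_^ℚ_ : ℚ → ℕ → ℚ
q ^ℚ zero  = 1ℚ
q ^ℚ suc n = q ℚ.* (q ^ℚ n)

ℕ→ℚ : ℕ → ℚ
ℕ→ℚ n = + n / 1

TendsToInfinity : (ℕ → ℕ) → Set
TendsToInfinity f = ∀ (B : ℕ) → ∃[ N ] (∀ n → N ℕ.≤ n → B ℕ.≤ f n)

-- Δ_{f,k}(n) ≤ d, i.e.  min { |f(n) - m^k| : m ∈ ℤ } ≤ d
-- (the minimum exists, and it is ≤ d iff some element of the set is ≤ d)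
ΔLe : (ℕ → ℕ) → ℕ → ℕ → ℚ → Set
ΔLe f k n d = ∃[ m ] ℕ→ℚ ∣ + f n ℤ.- m ℤ.^ k ∣ ℚ.≤ d

-- "s ≤ M_{f,k}(d)": M_{f,k}(d) (a maximum, or ∞) is at least s, i.e. some
-- n ≥ s (in ℕ = {1,2,...}) satisfies Δ_{f,k}(n) ≤ d.
AtLeastM : (ℕ → ℕ) → ℕ → ℚ → ℕ → Set
AtLeastM f k d s = ∃[ n ] (1 ℕ.≤ n × s ℕ.≤ n × ΔLe f k n d)

-- f(n) ≤ (1 - ε) · (2d/k)^{k/(k-1)}   (for 0 < ε < 1, d ≥ 0, k ≥ 2),
-- written equivalently (both sides nonnegative) after raising to the
-- power k-1 and clearing the denominator k^k:
--   f(n)^{k-1} · k^k ≤ (1-ε)^{k-1} · (2d)^k.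
BelowBound : (ℕ → ℕ) → ℕ → ℚ → ℚ → ℕ → Set
BelowBound f k ε d n =
  (ℕ→ℚ (f n) ^ℚ (k ℕ.∸ 1)) ℚ.* (ℕ→ℚ k ^ℚ k)
    ℚ.≤ ((1ℚ ℚ.- ε) ^ℚ (k ℕ.∸ 1)) ℚ.* ((ℕ→ℚ 2 ℚ.* d) ^ℚ k)

{-# OPTIONS --safe #-}
module Submission where

-- Let m^k ≤ x < (m+1)^k. Of the two k-th powers around x, the nearer one is within half the gap
-- (m+1)^k − m^k ≤ k(m+1)^(k−1) of x. Choose L with (L+1)(1−ε) ≤ L. Once m > L·k·2^(k−1) we have
-- L(m+1)^k ≤ (L+1)m^k, so L^(k−1)·gap^k ≤ k^k((L+1)x)^(k−1), and the hypothesis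
-- x^(k−1)k^k ≤ (1−ε)^(k−1)(2d)^k then forces gap ≤ 2d. For the finitely many smaller m, x itself is
-- below a constant D ≤ d, so 0^k is within d of x. Thus f(n) is within d of a k-th power for every n
-- in the set on the right, and n itself witnesses M_{f,k}(d) ≥ n.

open import Defs

module PowerGaps where

  open import Data.Nat using (ℕ; zero; suc; _+_; _*_; _^_; _∸_; _≤_; _<_; z≤n; s≤s; ∣_-_∣)
  open import Data.Nat.Properties
  open import Data.Nat.Tactic.RingSolver using (solve-∀)
  open import Data.Product using (_×_; _,_; ∃-syntax)
  open import Data.Sum as Sum using (_⊎_; inj₁; inj₂)
  open import Relation.Binary.PropositionalEquality
  open import Algebra.Properties.CommutativeSemigroup *-commutativeSemigroup using (x∙yz≈y∙xz; x∙yz≈y∙zx)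

  ^-distribʳ-* : ∀ m n o → (m * n) ^ o ≡ m ^ o * n ^ o
  ^-distribʳ-* m n zero    = refl
  ^-distribʳ-* m n (suc o) =
    trans (cong (m * n *_) (^-distribʳ-* m n o)) ([m*n]*[o*p]≡[m*o]*[n*p] m n (m ^ o) (n ^ o))

  [1+m]^[1+i]≤m^[1+i]+[1+i]*[1+m]^i : ∀ m i → suc m ^ suc i ≤ m ^ suc i + suc i * suc m ^ i
  [1+m]^[1+i]≤m^[1+i]+[1+i]*[1+m]^i m zero    = ≤-reflexive (+-comm 1 (m * 1))
  [1+m]^[1+i]≤m^[1+i]+[1+i]*[1+m]^i m (suc i) = begin
    suc m * suc m ^ suc i                                   ≤⟨ *-monoʳ-≤ (suc m) induction-hypothesis ⟩
    suc m * (m ^ suc i + suc i * suc m ^ i)                 ≡⟨ expand m (m ^ suc i) (suc i) (suc m ^ i) ⟩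
    m ^ suc (suc i) + (m ^ suc i + suc i * suc m ^ suc i)   ≤⟨ +-monoʳ-≤ (m ^ suc (suc i)) (+-monoˡ-≤ _ m^k≤[1+m]^k) ⟩
    m ^ suc (suc i) + suc (suc i) * suc m ^ suc i           ∎
    where
    open ≤-Reasoning
    induction-hypothesis : suc m ^ suc i ≤ m ^ suc i + suc i * suc m ^ i
    induction-hypothesis = [1+m]^[1+i]≤m^[1+i]+[1+i]*[1+m]^i m i
    m^k≤[1+m]^k : m ^ suc i ≤ suc m ^ suc i
    m^k≤[1+m]^k = ^-monoˡ-≤ (suc i) (n≤1+n m)
    expand : ∀ m a c b → suc m * (a + c * b) ≡ m * a + (a + c * (suc m * b))
    expand = solve-∀

  gap : ℕ → ℕ → ℕ
  gap k m = suc m ^ k ∸ m ^ k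

  gap≤k*[1+m]^[k-1] : ∀ j m → gap (suc j) m ≤ suc j * suc m ^ j
  gap≤k*[1+m]^[k-1] j m = m≤n+o⇒m∸n≤o (suc m ^ suc j) (m ^ suc j) ([1+m]^[1+i]≤m^[1+i]+[1+i]*[1+m]^i m j)

  strictlyIncreasing⇒bracketing : (g : ℕ → ℕ) → g 0 ≡ 0 → (∀ m → g m < g (suc m)) →
                                  ∀ x → ∃[ m ] (g m ≤ x × x < g (suc m))
  strictlyIncreasing⇒bracketing g g0≡0 g-inc zero =
    0 , ≤-reflexive g0≡0 , subst (_< g 1) g0≡0 (g-inc 0)
  strictlyIncreasing⇒bracketing g g0≡0 g-inc (suc x)
    with m , gm≤x , x<g[1+m] ← strictlyIncreasing⇒bracketing g g0≡0 g-inc x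
    with m≤n⇒m<n∨m≡n x<g[1+m]
  ... | inj₁ 1+x<g[1+m] = m , m≤n⇒m≤1+n gm≤x , 1+x<g[1+m]
  ... | inj₂ 1+x≡g[1+m] =
    suc m , ≤-reflexive (sym 1+x≡g[1+m]) , subst (_< g (2 + m)) (sym 1+x≡g[1+m]) (g-inc (suc m))

  ∃-bracketing-powers : ∀ j x → ∃[ m ] (m ^ suc j ≤ x × x < suc m ^ suc j)
  ∃-bracketing-powers j = strictlyIncreasing⇒bracketing (_^ suc j) refl (λ m → ^-monoˡ-< (suc j) (n<1+n m))

  L*[1+m]^k≤[1+L]*m^k : ∀ L j {m} → L * (suc j * 2 ^ j) < m → L * suc m ^ suc j ≤ suc L * m ^ suc j
  L*[1+m]^k≤[1+L]*m^k L j {m} L*k*2^j<m = begin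
    L * suc m ^ suc j                              ≤⟨ *-monoʳ-≤ L ([1+m]^[1+i]≤m^[1+i]+[1+i]*[1+m]^i m j) ⟩
    L * (m ^ suc j + suc j * suc m ^ j)            ≤⟨ *-monoʳ-≤ L (+-monoʳ-≤ (m ^ suc j) k*[1+m]^j≤k*2^j*m^j) ⟩
    L * (m * m ^ j + suc j * (2 ^ j * m ^ j))      ≡⟨ regroup L (suc j) m (2 ^ j) (m ^ j) ⟩
    L * (m * m ^ j) + L * (suc j * 2 ^ j) * m ^ j  ≤⟨ +-monoʳ-≤ (L * (m * m ^ j)) (*-monoˡ-≤ (m ^ j) (<⇒≤ L*k*2^j<m)) ⟩
    L * m ^ suc j + m ^ suc j                      ≡⟨ +-comm (L * m ^ suc j) (m ^ suc j) ⟩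
    suc L * m ^ suc j                              ∎
    where
    open ≤-Reasoning
    1≤m : 1 ≤ m
    1≤m = ≤-trans (s≤s z≤n) L*k*2^j<m
    1+m≤2*m : suc m ≤ 2 * m
    1+m≤2*m = subst (_≤ 2 * m) (+-comm m 1) (+-monoʳ-≤ m (≤-trans 1≤m (≤-reflexive (sym (+-identityʳ m)))))
    [1+m]^j≤2^j*m^j : suc m ^ j ≤ 2 ^ j * m ^ j
    [1+m]^j≤2^j*m^j = subst (suc m ^ j ≤_) (^-distribʳ-* 2 m j) (^-monoˡ-≤ j 1+m≤2*m)
    k*[1+m]^j≤k*2^j*m^j : suc j * suc m ^ j ≤ suc j * (2 ^ j * m ^ j)
    k*[1+m]^j≤k*2^j*m^j = *-monoʳ-≤ (suc j) [1+m]^j≤2^j*m^j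
    regroup : ∀ L k m a b → L * (m * b + k * (a * b)) ≡ L * (m * b) + L * (k * a) * b
    regroup = solve-∀

  L^j*gap^k≤[1+L]^j*[x^j*k^k] : ∀ L j {m x} → L * (suc j * 2 ^ j) < m → m ^ suc j ≤ x →
                                L ^ j * gap (suc j) m ^ suc j ≤ suc L ^ j * (x ^ j * suc j ^ suc j)
  L^j*gap^k≤[1+L]^j*[x^j*k^k] L j {m} {x} L*k*2^j<m m^k≤x = begin
    L ^ j * gap k m ^ k                 ≤⟨ *-monoʳ-≤ (L ^ j) (^-monoˡ-≤ k (gap≤k*[1+m]^[k-1] j m)) ⟩
    L ^ j * (k * suc m ^ j) ^ k         ≡⟨ cong (L ^ j *_) (^-distribʳ-* k (suc m ^ j) k) ⟩
    L ^ j * (k ^ k * (suc m ^ j) ^ k)   ≡⟨ cong (λ y → L ^ j * (k ^ k * y)) [1+m]^j^k≡[1+m]^k^j ⟩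
    L ^ j * (k ^ k * (suc m ^ k) ^ j)   ≡⟨ x∙yz≈y∙xz (L ^ j) (k ^ k) _ ⟩
    k ^ k * (L ^ j * (suc m ^ k) ^ j)   ≡⟨ cong (k ^ k *_) (^-distribʳ-* L (suc m ^ k) j) ⟨
    k ^ k * (L * suc m ^ k) ^ j         ≤⟨ *-monoʳ-≤ (k ^ k) (^-monoˡ-≤ j (L*[1+m]^k≤[1+L]*m^k L j L*k*2^j<m)) ⟩
    k ^ k * (suc L * m ^ k) ^ j         ≤⟨ *-monoʳ-≤ (k ^ k) (^-monoˡ-≤ j (*-monoʳ-≤ (suc L) m^k≤x)) ⟩
    k ^ k * (suc L * x) ^ j             ≡⟨ cong (k ^ k *_) (^-distribʳ-* (suc L) x j) ⟩
    k ^ k * (suc L ^ j * x ^ j)         ≡⟨ x∙yz≈y∙zx (k ^ k) (suc L ^ j) (x ^ j) ⟩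
    suc L ^ j * (x ^ j * k ^ k)         ∎
    where
    open ≤-Reasoning
    k : ℕ
    k = suc j
    [1+m]^j^k≡[1+m]^k^j : (suc m ^ j) ^ k ≡ (suc m ^ k) ^ j
    [1+m]^j^k≡[1+m]^k^j = begin-equality
      (suc m ^ j) ^ k  ≡⟨ ^-*-assoc (suc m) j k ⟩
      suc m ^ (j * k)  ≡⟨ cong (suc m ^_) (*-comm j k) ⟩
      suc m ^ (k * j)  ≡⟨ ^-*-assoc (suc m) k j ⟨
      (suc m ^ k) ^ j  ∎

  nearer-endpoint : ∀ {u x v} → u ≤ x → x ≤ v → 2 * ∣ x - u ∣ ≤ v ∸ u ⊎ 2 * ∣ x - v ∣ ≤ v ∸ u
  nearer-endpoint {u} {x} {v} u≤x x≤v = Sum.map lower-nearer upper-nearer (≤-total (x ∸ u) (v ∸ x))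
    where
    open ≤-Reasoning
    2*a≤a+b : ∀ {a b} → a ≤ b → 2 * a ≤ a + b
    2*a≤a+b {a} a≤b = +-monoʳ-≤ a (≤-trans (≤-reflexive (+-identityʳ a)) a≤b)
    [x∸u]+[v∸x]≡v∸u : (x ∸ u) + (v ∸ x) ≡ v ∸ u
    [x∸u]+[v∸x]≡v∸u = begin-equality
      (x ∸ u) + (v ∸ x)  ≡⟨ +-comm (x ∸ u) (v ∸ x) ⟩
      (v ∸ x) + (x ∸ u)  ≡⟨ +-∸-assoc (v ∸ x) u≤x ⟨
      (v ∸ x + x) ∸ u    ≡⟨ cong (_∸ u) (m∸n+n≡m x≤v) ⟩
      v ∸ u              ∎
    lower-nearer : x ∸ u ≤ v ∸ x → 2 * ∣ x - u ∣ ≤ v ∸ u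
    lower-nearer a≤b = begin
      2 * ∣ x - u ∣      ≡⟨ cong (2 *_) (m≤n⇒∣n-m∣≡n∸m u≤x) ⟩
      2 * (x ∸ u)        ≤⟨ 2*a≤a+b a≤b ⟩
      (x ∸ u) + (v ∸ x)  ≡⟨ [x∸u]+[v∸x]≡v∸u ⟩
      v ∸ u              ∎
    upper-nearer : v ∸ x ≤ x ∸ u → 2 * ∣ x - v ∣ ≤ v ∸ u
    upper-nearer b≤a = begin
      2 * ∣ x - v ∣      ≡⟨ cong (2 *_) (m≤n⇒∣m-n∣≡n∸m x≤v) ⟩
      2 * (v ∸ x)        ≤⟨ 2*a≤a+b b≤a ⟩
      (v ∸ x) + (x ∸ u)  ≡⟨ +-comm (v ∸ x) (x ∸ u) ⟩
      (x ∸ u) + (v ∸ x)  ≡⟨ [x∸u]+[v∸x]≡v∸u ⟩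
      v ∸ u              ∎


module RationalArithmetic where

  open import Data.Nat as ℕ using (ℕ; zero; suc)
  import Data.Nat.Properties as ℕ
  open import Data.Nat.Coprimality using (1-coprimeTo)
  import Data.Nat.Coprimality as Coprime
  open import Data.Integer as ℤ using (+_; +[1+_]; -[1+_])
  import Data.Integer.Properties as ℤ
  open import Data.Rational
    using (ℚ; mkℚ; 0ℚ; 1ℚ; _≤_; _<_; _*_; _+_; _-_; -_; ↧ₙ_; _/_; positive; nonNegative; *≤*; *<*)
  open import Data.Rational.Properties
  import Data.Rational.Unnormalised as ℚᵘ
  import Data.Rational.Unnormalised.Properties as ℚᵘ
  open import Data.Rational.Solver using (module +-*-Solver)
  open import Data.Product using (_×_; _,_; ∃-syntax)
  open import Relation.Binary.PropositionalEquality
  open import Algebra.Bundles using (CommutativeMonoid)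
  open import Algebra.Properties.CommutativeSemigroup
    (CommutativeMonoid.commutativeSemigroup *-1-commutativeMonoid) using (interchange)

  ℕ→ℚ≡mkℚ : ∀ n → ℕ→ℚ n ≡ mkℚ (+ n) 0 (Coprime.sym (1-coprimeTo n))
  ℕ→ℚ≡mkℚ n = normalize-coprime _

  ℕ→ℚ-homo-+ : ∀ m n → ℕ→ℚ (m ℕ.+ n) ≡ ℕ→ℚ m + ℕ→ℚ n
  ℕ→ℚ-homo-+ m n rewrite ℕ→ℚ≡mkℚ m | ℕ→ℚ≡mkℚ n =
    cong (_/ 1) (trans (ℤ.pos-+ m n) (sym (cong₂ ℤ._+_ (ℤ.*-identityʳ (+ m)) (ℤ.*-identityʳ (+ n)))))

  ℕ→ℚ-homo-* : ∀ m n → ℕ→ℚ (m ℕ.* n) ≡ ℕ→ℚ m * ℕ→ℚ n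
  ℕ→ℚ-homo-* m n rewrite ℕ→ℚ≡mkℚ m | ℕ→ℚ≡mkℚ n = cong (_/ 1) (ℤ.pos-* m n)

  ℕ→ℚ-homo-^ : ∀ m n → ℕ→ℚ (m ℕ.^ n) ≡ ℕ→ℚ m ^ℚ n
  ℕ→ℚ-homo-^ m zero    = refl
  ℕ→ℚ-homo-^ m (suc n) = trans (ℕ→ℚ-homo-* m (m ℕ.^ n)) (cong (ℕ→ℚ m *_) (ℕ→ℚ-homo-^ m n))

  ℕ→ℚ-homo-^*^ : ∀ a m b n → ℕ→ℚ (a ℕ.^ m ℕ.* b ℕ.^ n) ≡ ℕ→ℚ a ^ℚ m * ℕ→ℚ b ^ℚ n
  ℕ→ℚ-homo-^*^ a m b n =
    trans (ℕ→ℚ-homo-* (a ℕ.^ m) (b ℕ.^ n)) (cong₂ _*_ (ℕ→ℚ-homo-^ a m) (ℕ→ℚ-homo-^ b n))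

  ℕ→ℚ-mono-≤ : ∀ {m n} → m ℕ.≤ n → ℕ→ℚ m ≤ ℕ→ℚ n
  ℕ→ℚ-mono-≤ {m} {n} m≤n rewrite ℕ→ℚ≡mkℚ m | ℕ→ℚ≡mkℚ n =
    *≤* (subst₂ ℤ._≤_ (sym (ℤ.*-identityʳ (+ m))) (sym (ℤ.*-identityʳ (+ n))) (ℤ.+≤+ m≤n))

  ℕ→ℚ-mono-< : ∀ {m n} → m ℕ.< n → ℕ→ℚ m < ℕ→ℚ n
  ℕ→ℚ-mono-< {m} {n} m<n rewrite ℕ→ℚ≡mkℚ m | ℕ→ℚ≡mkℚ n =
    *<* (subst₂ ℤ._<_ (sym (ℤ.*-identityʳ (+ m))) (sym (ℤ.*-identityʳ (+ n))) (ℤ.+<+ m<n))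

  0≤ℕ→ℚ : ∀ n → 0ℚ ≤ ℕ→ℚ n
  0≤ℕ→ℚ n = ℕ→ℚ-mono-≤ {0} {n} ℕ.z≤n

  0≤p⇒0≤q⇒0≤p*q : ∀ {p q} → 0ℚ ≤ p → 0ℚ ≤ q → 0ℚ ≤ p * q
  0≤p⇒0≤q⇒0≤p*q {p} {q} 0≤p 0≤q =
    nonNegative⁻¹ _ {{nonNeg*nonNeg⇒nonNeg p {{nonNegative 0≤p}} q {{nonNegative 0≤q}}}}

  p<1⇒0≤1-p : ∀ {p} → p < 1ℚ → 0ℚ ≤ 1ℚ - p
  p<1⇒0≤1-p {p} p<1 = subst (_≤ 1ℚ - p) (+-inverseʳ p) (+-monoˡ-≤ (- p) (<⇒≤ p<1))

  2*m≤n⇒m≤d : ∀ m {n d} → 2 ℕ.* m ℕ.≤ n → ℕ→ℚ n ≤ ℕ→ℚ 2 * d → ℕ→ℚ m ≤ d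
  2*m≤n⇒m≤d m {n} 2m≤n n≤2d =
    *-cancelˡ-≤-pos (ℕ→ℚ 2) (≤-trans (subst (_≤ ℕ→ℚ n) (ℕ→ℚ-homo-* 2 m) (ℕ→ℚ-mono-≤ 2m≤n)) n≤2d)

  ^ℚ-distribʳ-* : ∀ p q n → (p * q) ^ℚ n ≡ p ^ℚ n * q ^ℚ n
  ^ℚ-distribʳ-* p q zero    = refl
  ^ℚ-distribʳ-* p q (suc n) =
    trans (cong (p * q *_) (^ℚ-distribʳ-* p q n)) (interchange p q (p ^ℚ n) (q ^ℚ n))

  0≤p⇒0≤p^n : ∀ {p} n → 0ℚ ≤ p → 0ℚ ≤ p ^ℚ n
  0≤p⇒0≤p^n zero    0≤p = nonNegative⁻¹ 1ℚ
  0≤p⇒0≤p^n (suc n) 0≤p = 0≤p⇒0≤q⇒0≤p*q 0≤p (0≤p⇒0≤p^n n 0≤p)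

  0<p⇒0<p^n : ∀ {p} n → 0ℚ < p → 0ℚ < p ^ℚ n
  0<p⇒0<p^n zero    0<p = positive⁻¹ 1ℚ
  0<p⇒0<p^n {p} (suc n) 0<p = subst (_< p * p ^ℚ n) (*-zeroʳ p)
    (*-monoʳ-<-pos p {{positive 0<p}} (0<p⇒0<p^n n 0<p))

  ^ℚ-monoˡ-≤ : ∀ {p q} n → 0ℚ ≤ p → p ≤ q → p ^ℚ n ≤ q ^ℚ n
  ^ℚ-monoˡ-≤ zero    0≤p p≤q = ≤-refl
  ^ℚ-monoˡ-≤ {p} {q} (suc n) 0≤p p≤q = ≤-trans
    (*-monoʳ-≤-nonNeg (p ^ℚ n) {{nonNegative (0≤p⇒0≤p^n n 0≤p)}} p≤q)
    (*-monoˡ-≤-nonNeg q {{nonNegative (≤-trans 0≤p p≤q)}} (^ℚ-monoˡ-≤ n 0≤p p≤q))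

  ^ℚ-monoˡ-< : ∀ {p q} n → 0ℚ ≤ p → p < q → p ^ℚ suc n < q ^ℚ suc n
  ^ℚ-monoˡ-< {p} {q} n 0≤p p<q = ≤-<-trans
    (*-monoˡ-≤-nonNeg p {{nonNegative 0≤p}} (^ℚ-monoˡ-≤ n 0≤p (<⇒≤ p<q)))
    (*-monoˡ-<-pos (q ^ℚ n) {{positive (0<p⇒0<p^n n (≤-<-trans 0≤p p<q))}} p<q)

  ^ℚ-cancelˡ-≤ : ∀ {p q} n → 0ℚ ≤ q → p ^ℚ suc n ≤ q ^ℚ suc n → p ≤ q
  ^ℚ-cancelˡ-≤ n 0≤q p^n≤q^n =
    ≮⇒≥ (λ q<p → <-irrefl refl (<-≤-trans (^ℚ-monoˡ-< n 0≤q q<p) p^n≤q^n))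

  1≤↧p*p : ∀ p → 0ℚ < p → 1ℚ ≤ ℕ→ℚ (↧ₙ p) * p
  1≤↧p*p p@(mkℚ +[1+ n ] d _) _ rewrite ℕ→ℚ≡mkℚ (suc d) =
    toℚᵘ-cancel-≤ (ℚᵘ.≤-respʳ-≃ (ℚᵘ.≃-sym (toℚᵘ-homo-* ↧p p)) (ℚᵘ.*≤* (ℤ.+≤+ 1+d≤[1+d]*[1+n])))
    where
    ↧p : ℚ
    ↧p = mkℚ (+ suc d) 0 (Coprime.sym (1-coprimeTo (suc d)))
    -- the two sides are Agda's normal forms of the denominator and numerator of (1+d)·p in ℚᵘ
    1+d≤[1+d]*[1+n] : suc (d ℕ.+ 0 ℕ.+ 0) ℕ.≤ suc ((n ℕ.+ d ℕ.* suc n) ℕ.* 1)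
    1+d≤[1+d]*[1+n] = subst₂ ℕ._≤_ (cong suc (sym (trans (ℕ.+-identityʳ _) (ℕ.+-identityʳ d))))
                                (cong suc (sym (ℕ.*-identityʳ _))) (ℕ.m≤m*n (suc d) (suc n))
  1≤↧p*p (mkℚ (+ zero) _ _) (*<* (ℤ.+<+ ()))
  1≤↧p*p (mkℚ -[1+ _ ] _ _) (*<* ())

  [1+l]*[1-e]≤l : ∀ {l e} → 0ℚ ≤ e → 1ℚ ≤ l * e → (1ℚ + l) * (1ℚ - e) ≤ l
  [1+l]*[1-e]≤l {l} {e} 0≤e 1≤l*e = begin
    (1ℚ + l) * (1ℚ - e)     ≡⟨ expand l e ⟩
    l + (1ℚ - (e + l * e))  ≤⟨ +-monoʳ-≤ l 1-[e+le]≤0 ⟩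
    l + 0ℚ                  ≡⟨ +-identityʳ l ⟩
    l                       ∎
    where
    open ≤-Reasoning
    open +-*-Solver
    expand : ∀ l e → (1ℚ + l) * (1ℚ - e) ≡ l + (1ℚ - (e + l * e))
    expand = solve 2 (λ l e → (con 1ℚ :+ l) :* (con 1ℚ :- e) := l :+ (con 1ℚ :- (e :+ l :* e))) refl
    1≤e+le : 1ℚ ≤ e + l * e
    1≤e+le = ≤-trans 1≤l*e (subst (_≤ e + l * e) (+-identityˡ (l * e)) (+-monoˡ-≤ (l * e) 0≤e))
    1-[e+le]≤0 : 1ℚ - (e + l * e) ≤ 0ℚ
    1-[e+le]≤0 = subst (1ℚ - (e + l * e) ≤_) (+-inverseʳ (e + l * e)) (+-monoˡ-≤ (- (e + l * e)) 1≤e+le)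

  ∃[L][1+L]*[1-ε]≤L : ∀ {ε} → 0ℚ < ε → ∃[ L ] (1 ℕ.≤ L × ℕ→ℚ (suc L) * (1ℚ - ε) ≤ ℕ→ℚ L)
  ∃[L][1+L]*[1-ε]≤L {ε} 0<ε = ↧ₙ ε , ℕ.s≤s ℕ.z≤n ,
    subst (λ l → l * (1ℚ - ε) ≤ ℕ→ℚ (↧ₙ ε)) (sym (ℕ→ℚ-homo-+ 1 (↧ₙ ε)))
      ([1+l]*[1-e]≤l (<⇒≤ 0<ε) (1≤↧p*p ε 0<ε))


open PowerGaps using (gap; ∃-bracketing-powers; L^j*gap^k≤[1+L]^j*[x^j*k^k]; nearer-endpoint)
open RationalArithmetic
open import Data.Nat using (ℕ; zero; suc)
import Data.Nat as ℕ
import Data.Nat.Properties as ℕ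
open import Data.Integer as ℤ using (+_)
import Data.Integer.Properties as ℤ
open import Data.Rational using (ℚ; 0ℚ; 1ℚ; _≤_; _<_; _*_; NonNegative; positive; nonNegative)
open import Data.Rational.Properties
  using (*-assoc; *-monoˡ-≤-nonNeg; *-monoʳ-≤-nonNeg; *-cancelˡ-≤-pos; module ≤-Reasoning)
open import Data.Product using (_,_; ∃-syntax)
open import Data.Sum using (inj₁; inj₂)
open import Relation.Binary.PropositionalEquality using (_≡_; refl; sym; trans; cong; cong₂; subst)

+m^n≡+[m^n] : ∀ m n → (+ m) ℤ.^ n ≡ + (m ℕ.^ n)
+m^n≡+[m^n] m zero    = refl
+m^n≡+[m^n] m (suc n) = trans (cong (+ m ℤ.*_) (+m^n≡+[m^n] m n)) (sym (ℤ.pos-* m (m ℕ.^ n)))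

∣m⊖n∣≡∣m-n∣ : ∀ m n → ℤ.∣ m ℤ.⊖ n ∣ ≡ ℕ.∣ m - n ∣
∣m⊖n∣≡∣m-n∣ zero    zero    = refl
∣m⊖n∣≡∣m-n∣ zero    (suc n) = refl
∣m⊖n∣≡∣m-n∣ (suc m) zero    = refl
∣m⊖n∣≡∣m-n∣ (suc m) (suc n) = trans (cong ℤ.∣_∣ (ℤ.[1+m]⊖[1+n]≡m⊖n m n)) (∣m⊖n∣≡∣m-n∣ m n)

-- ΔLe f k n d unfolds to NearPower k d (f n).
NearPower : ℕ → ℚ → ℕ → Set
NearPower k d x = ∃[ z ] ℕ→ℚ ℤ.∣ + x ℤ.- z ℤ.^ k ∣ ≤ d

nearPower-intro : ∀ {d} k x z → ℕ→ℚ ℕ.∣ x - z ℕ.^ k ∣ ≤ d → NearPower k d x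
nearPower-intro k x z ∣x-z^k∣≤d = + z , subst (_≤ _) (cong ℕ→ℚ (sym ∣+x-+z^k∣≡∣x-z^k∣)) ∣x-z^k∣≤d
  where
  ∣+x-+z^k∣≡∣x-z^k∣ : ℤ.∣ + x ℤ.- (+ z) ℤ.^ k ∣ ≡ ℕ.∣ x - z ℕ.^ k ∣
  ∣+x-+z^k∣≡∣x-z^k∣ = trans (cong (λ i → ℤ.∣ + x ℤ.- i ∣) (+m^n≡+[m^n] z k))
                            (trans (cong ℤ.∣_∣ (ℤ.m-n≡m⊖n x (z ℕ.^ k))) (∣m⊖n∣≡∣m-n∣ x (z ℕ.^ k)))

nearPower-of-gap≤2d : ∀ {d} k x m → m ℕ.^ k ℕ.≤ x → x ℕ.≤ suc m ℕ.^ k →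
                      ℕ→ℚ (gap k m) ≤ ℕ→ℚ 2 * d → NearPower k d x
nearPower-of-gap≤2d k x m m^k≤x x≤[1+m]^k gap≤2d with nearer-endpoint m^k≤x x≤[1+m]^k
... | inj₁ lower-nearer = nearPower-intro k x m (2*m≤n⇒m≤d ℕ.∣ x - m ℕ.^ k ∣ lower-nearer gap≤2d)
... | inj₂ upper-nearer = nearPower-intro k x (suc m) (2*m≤n⇒m≤d ℕ.∣ x - suc m ℕ.^ k ∣ upper-nearer gap≤2d)

threshold : ℕ → ℕ → ℕ
threshold j L = suc (L ℕ.* (suc j ℕ.* 2 ℕ.^ j))

module _ (j : ℕ) {L : ℕ} (1≤L : 1 ℕ.≤ L) {r : ℚ} (0≤r : 0ℚ ≤ r)
         ([1+L]*r≤L : ℕ→ℚ (suc L) * r ≤ ℕ→ℚ L) where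

  gap≤2d : ∀ {d x m} → 0ℚ ≤ d → threshold j L ℕ.≤ m → m ℕ.^ suc j ℕ.≤ x →
           ℕ→ℚ x ^ℚ j * ℕ→ℚ (suc j) ^ℚ suc j ≤ r ^ℚ j * (ℕ→ℚ 2 * d) ^ℚ suc j →
           ℕ→ℚ (gap (suc j) m) ≤ ℕ→ℚ 2 * d
  gap≤2d {d} {x} {m} 0≤d threshold≤m m^k≤x x^j*k^k≤r^j*T^k =
    ^ℚ-cancelˡ-≤ j 0≤T (*-cancelˡ-≤-pos (l ^ℚ j) {{positive 0<l^j}} (begin
      l ^ℚ j * G ^ℚ k                              ≡⟨ ℕ→ℚ-homo-^*^ L j (gap k m) k ⟨
      ℕ→ℚ (L ℕ.^ j ℕ.* gap k m ℕ.^ k)              ≤⟨ ℕ→ℚ-mono-≤ (L^j*gap^k≤[1+L]^j*[x^j*k^k] L j threshold≤m m^k≤x) ⟩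
      ℕ→ℚ (suc L ℕ.^ j ℕ.* (x ℕ.^ j ℕ.* k ℕ.^ k))  ≡⟨ ℕ→ℚ-homo-[1+L]^j*[x^j*k^k] ⟩
      l′ ^ℚ j * (ℕ→ℚ x ^ℚ j * ℕ→ℚ k ^ℚ k)          ≤⟨ *-monoˡ-≤-nonNeg (l′ ^ℚ j) {{l′^j-nonNeg}} x^j*k^k≤r^j*T^k ⟩
      l′ ^ℚ j * (r ^ℚ j * T ^ℚ k)                  ≡⟨ *-assoc (l′ ^ℚ j) (r ^ℚ j) (T ^ℚ k) ⟨
      l′ ^ℚ j * r ^ℚ j * T ^ℚ k                    ≡⟨ cong (_* T ^ℚ k) (^ℚ-distribʳ-* l′ r j) ⟨
      (l′ * r) ^ℚ j * T ^ℚ k                       ≤⟨ *-monoʳ-≤-nonNeg (T ^ℚ k) {{T^k-nonNeg}} [l′r]^j≤l^j ⟩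
      l ^ℚ j * T ^ℚ k                              ∎))
    where
    open ≤-Reasoning
    k : ℕ
    k = suc j
    l l′ G T : ℚ
    l = ℕ→ℚ L
    l′ = ℕ→ℚ (suc L)
    G = ℕ→ℚ (gap k m)
    T = ℕ→ℚ 2 * d
    0≤T : 0ℚ ≤ T
    0≤T = 0≤p⇒0≤q⇒0≤p*q (0≤ℕ→ℚ 2) 0≤d
    0<l^j : 0ℚ < l ^ℚ j
    0<l^j = 0<p⇒0<p^n j (ℕ→ℚ-mono-< 1≤L)
    l′^j-nonNeg : NonNegative (l′ ^ℚ j)
    l′^j-nonNeg = nonNegative (0≤p⇒0≤p^n j (0≤ℕ→ℚ (suc L)))
    T^k-nonNeg : NonNegative (T ^ℚ k)
    T^k-nonNeg = nonNegative (0≤p⇒0≤p^n k 0≤T)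
    [l′r]^j≤l^j : (l′ * r) ^ℚ j ≤ l ^ℚ j
    [l′r]^j≤l^j = ^ℚ-monoˡ-≤ j (0≤p⇒0≤q⇒0≤p*q (0≤ℕ→ℚ (suc L)) 0≤r) [1+L]*r≤L
    ℕ→ℚ-homo-[1+L]^j*[x^j*k^k] :
      ℕ→ℚ (suc L ℕ.^ j ℕ.* (x ℕ.^ j ℕ.* k ℕ.^ k)) ≡ l′ ^ℚ j * (ℕ→ℚ x ^ℚ j * ℕ→ℚ k ^ℚ k)
    ℕ→ℚ-homo-[1+L]^j*[x^j*k^k] =
      trans (ℕ→ℚ-homo-* (suc L ℕ.^ j) _) (cong₂ _*_ (ℕ→ℚ-homo-^ (suc L) j) (ℕ→ℚ-homo-^*^ x j k k))

  nearPower-below-bound : ∀ {d} x → 0ℚ ≤ d → ℕ→ℚ (threshold j L ℕ.^ suc j) ≤ d →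
                          ℕ→ℚ x ^ℚ j * ℕ→ℚ (suc j) ^ℚ suc j ≤ r ^ℚ j * (ℕ→ℚ 2 * d) ^ℚ suc j →
                          NearPower (suc j) d x
  nearPower-below-bound {d} x 0≤d D≤d x^j*k^k≤r^j*T^k
    with m , m^k≤x , x<[1+m]^k ← ∃-bracketing-powers j x
    with ℕ.<-≤-connex m (threshold j L)
  ... | inj₂ threshold≤m = nearPower-of-gap≤2d (suc j) x m m^k≤x (ℕ.<⇒≤ x<[1+m]^k)
                             (gap≤2d 0≤d threshold≤m m^k≤x x^j*k^k≤r^j*T^k)
  ... | inj₁ m<threshold = nearPower-intro (suc j) x 0 (begin
    ℕ→ℚ ℕ.∣ x - 0 ∣                   ≡⟨ cong ℕ→ℚ (ℕ.∣-∣-identityʳ x) ⟩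
    ℕ→ℚ x                             ≤⟨ ℕ→ℚ-mono-≤ (ℕ.≤-trans (ℕ.<⇒≤ x<[1+m]^k) (ℕ.^-monoˡ-≤ (suc j) m<threshold)) ⟩
    ℕ→ℚ (threshold j L ℕ.^ suc j)     ≤⟨ D≤d ⟩
    d                                 ∎)
    where open ≤-Reasoning

proposition3p3 : (f : ℕ → ℕ) → (∀ n → 1 ℕ.≤ n → 1 ℕ.≤ f n) →
    TendsToInfinity f → (k : ℕ) → 2 ℕ.≤ k →
    (ε : ℚ) → 0ℚ < ε → ε < 1ℚ →
    ∃[ D ] (∀ (d : ℚ) → 0ℚ ≤ d → D ≤ d →
    ∀ (n : ℕ) → 1 ℕ.≤ n → BelowBound f k ε d n → AtLeastM f k d n)
proposition3p3 _ _ _ zero ()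
proposition3p3 f _ _ (suc j) _ ε 0<ε ε<1 =
  let L , 1≤L , [1+L]*[1-ε]≤L = ∃[L][1+L]*[1-ε]≤L 0<ε in
  ℕ→ℚ (threshold j L ℕ.^ suc j) ,
  λ d 0≤d D≤d n 1≤n below →
    n , 1≤n , ℕ.≤-refl , nearPower-below-bound j 1≤L (p<1⇒0≤1-p ε<1) [1+L]*[1-ε]≤L (f n) 0≤d D≤d below
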